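{- For powers of two $1<k<n$, $A(n,k)\le B(n,k)$, where $A(n,k)=B(n/2,k)+B(n/2,k/2)+\frac n2+\frac{k\log_2k}{2}$.
   Context: For powers of two $1\le k\le n$, $B(n,k)=\frac14n\log_2^2k+\frac14n\log_2k+2n-\frac12k\log_2k-k-\frac nk$ is the number of comparators of the bitonic selection network $bit\_sel^n_k$; $A(n,k)$ is the number of comparators of the network obtained from the improved pairwise selection network by replacing its two recursive calls (on $n/2$ inputs selecting $k$ and $k/2$ elements) by bitonic selection networks, followed by a splitter ($n/2$ comparators) and the improved merger ($\frac{k\log_2 k}{2}$ comparators). -}

module Defs where

open import Data.Nat using (ℕ; _^_; _∸_; _*_)
open import Data.Integer using (ℤ; +_; _+_; _-_)

-- For powers of two n = 2^a, k = 2^b with b ≤ a (so log₂ n = a, log₂ k = b,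
-- and n/k = 2^(a ∸ b) exactly), we use  4·B(n,k)  to stay in the integers:
-- 4B = n·log²k + n·logk + 8n − 2k·logk − 4k − 4(n/k).
B4 : ℕ → ℕ → ℤ
B4 a b = + (n * (b * b)) + + (n * b) + + (8 * n) - + (2 * k * b) - + (4 * k) - + (4 * 2 ^ (a ∸ b))
  where
  n = 2 ^ a
  k = 2 ^ b

-- 4·A(n,k) = 4B(n/2,k) + 4B(n/2,k/2) + 2n + 2k·log₂k,  with n = 2^a, k = 2^b, 1 ≤ b < a.
A4 : ℕ → ℕ → ℤ
A4 a b = B4 (a ∸ 1) b + B4 (a ∸ 1) (b ∸ 1) + + (2 * 2 ^ a) + + (2 * 2 ^ b * b)

-- Write k = 2^(1+l) and n = 2^(2+l+c), so that n = 4KR and k = 2K with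
-- K = 2^l, R = 2^c. After the negative terms are moved across, 4A ≤ 4B is a
-- polynomial inequality in K, R, l, and in fact
--   4(B − A) = 2R(lK + 2 − 2K) + 2Kl(R − 1),
-- which is nonnegative because 2^(l+1) ≤ 2 + l·2^l and R ≥ 1.
module Submission where

open import Defs
open import Data.Nat using (ℕ; zero; suc; _+_; _*_; _^_; _∸_; _≤_; _<_)
open import Data.Nat.Properties
open import Data.Integer as ℤ using (+_; _⊖_) renaming (_≤_ to _≤ℤ_)
import Data.Integer.Properties as ℤ
open import Data.Product using (_,_)
open import Relation.Binary.PropositionalEquality
import Data.Nat.Tactic.RingSolver as ℕ-Solver
import Data.Integer.Tactic.RingSolver as ℤ-Solver

2*2^n≤2+n*2^n : ∀ n → 2 * 2 ^ n ≤ 2 + n * 2 ^ n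
2*2^n≤2+n*2^n zero    = ≤-refl
2*2^n≤2+n*2^n (suc n) = begin
  2 * (2 * 2 ^ n)                   ≤⟨ *-monoʳ-≤ 2 (2*2^n≤2+n*2^n n) ⟩
  2 * (2 + n * 2 ^ n)               ≡⟨ double n (2 ^ n) ⟩
  2 + (2 + n * (2 * 2 ^ n))         ≤⟨ +-monoʳ-≤ 2 (+-monoˡ-≤ (n * (2 * 2 ^ n)) (*-monoʳ-≤ 2 (m^n>0 2 n))) ⟩
  2 + (2 * 2 ^ n + n * (2 * 2 ^ n)) ∎
  where
  open ≤-Reasoning
  double : ∀ n x → 2 * (2 + n * x) ≡ 2 + (2 + n * (2 * x))
  double = ℕ-Solver.solve-∀

suc[m+n]∸m≡suc[n] : ∀ m n → suc (m + n) ∸ m ≡ suc n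
suc[m+n]∸m≡suc[n] m n = trans (cong (_∸ m) (sym (+-suc m n))) (m+n∸m≡n m (suc n))

-- 4B(n,k) = B4⁺ n (log₂ k) − B4⁻ k (n/k) (log₂ k) and
-- 4A(n,k) = A4⁺ (n/2) (k/2) (log₂ k − 1) − A4⁻ (k/2) (n/2k) (n/k) (log₂ k − 1).
-- They are INLINE because the ring solver does not unfold definitions.
B4⁺ : ℕ → ℕ → ℕ
B4⁺ n l = n * (l * l) + n * l + 8 * n
{-# INLINE B4⁺ #-}

B4⁻ : ℕ → ℕ → ℕ → ℕ
B4⁻ k r l = 2 * k * l + 4 * k + 4 * r
{-# INLINE B4⁻ #-}

A4⁺ : ℕ → ℕ → ℕ → ℕ
A4⁺ h K l = B4⁺ h (suc l) + B4⁺ h l + 2 * (2 * h) + 2 * (2 * K) * suc l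
{-# INLINE A4⁺ #-}

A4⁻ : ℕ → ℕ → ℕ → ℕ → ℕ
A4⁻ K d d′ l = B4⁻ (2 * K) d (suc l) + B4⁻ K d′ l
{-# INLINE A4⁻ #-}

[+m]-[+n]≤[+o]-[+p] : ∀ {m n o p} → m + p ≤ o + n → + m ℤ.- + n ≤ℤ + o ℤ.- + p
[+m]-[+n]≤[+o]-[+p] {m} {n} {o} {p} m+p≤o+n = begin
  + m ℤ.- + n       ≡⟨ ℤ.[+m]-[+n]≡m⊖n m n ⟩
  m ⊖ n             ≡⟨ ℤ.+-cancelˡ-⊖ p m n ⟨
  (p + m) ⊖ (p + n) ≤⟨ ℤ.⊖-monoˡ-≤ (p + n) (subst₂ _≤_ (+-comm m p) (+-comm o n) m+p≤o+n) ⟩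
  (n + o) ⊖ (p + n) ≡⟨ cong ((n + o) ⊖_) (+-comm p n) ⟩
  (n + o) ⊖ (n + p) ≡⟨ ℤ.+-cancelˡ-⊖ n o p ⟩
  o ⊖ p             ≡⟨ ℤ.[+m]-[+n]≡m⊖n o p ⟨
  + o ℤ.- + p       ∎
  where open ℤ.≤-Reasoning

pos-+³ : ∀ x y z → + (x + y + z) ≡ + x ℤ.+ + y ℤ.+ + z
pos-+³ x y z = trans (ℤ.pos-+ (x + y) z) (cong (ℤ._+ + z) (ℤ.pos-+ x y))

B4≡B4⁺-B4⁻ : ∀ {a b n r} → 2 ^ a ≡ n → 2 ^ (a ∸ b) ≡ r →
             B4 a b ≡ + B4⁺ n b ℤ.- + B4⁻ (2 ^ b) r b
B4≡B4⁺-B4⁻ {a} {b} refl refl = begin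
  B4 a b
    ≡⟨ regroup (+ (n * (b * b))) (+ (n * b)) (+ (8 * n)) (+ (2 * k * b)) (+ (4 * k)) (+ (4 * r)) ⟩
  (+ (n * (b * b)) ℤ.+ + (n * b) ℤ.+ + (8 * n)) ℤ.- (+ (2 * k * b) ℤ.+ + (4 * k) ℤ.+ + (4 * r))
    ≡⟨ cong₂ ℤ._-_ (pos-+³ (n * (b * b)) (n * b) (8 * n)) (pos-+³ (2 * k * b) (4 * k) (4 * r)) ⟨
  + B4⁺ n b ℤ.- + B4⁻ k r b
    ∎
  where
  open ≡-Reasoning
  n k r : ℕ
  n = 2 ^ a
  k = 2 ^ b
  r = 2 ^ (a ∸ b)
  regroup : ∀ x y z u v w → x ℤ.+ y ℤ.+ z ℤ.- u ℤ.- v ℤ.- w ≡ (x ℤ.+ y ℤ.+ z) ℤ.- (u ℤ.+ v ℤ.+ w)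
  regroup = ℤ-Solver.solve-∀

A4≡A4⁺-A4⁻ : ∀ {a b h d d′} → 2 ^ a ≡ h → 2 ^ (a ∸ suc b) ≡ d → 2 ^ (a ∸ b) ≡ d′ →
             A4 (suc a) (suc b) ≡ + A4⁺ h (2 ^ b) b ℤ.- + A4⁻ (2 ^ b) d d′ b
A4≡A4⁺-A4⁻ {a} {b} refl refl refl = begin
  A4 (suc a) (suc b)                                ≡⟨ cong₂ (λ u v → u ℤ.+ v ℤ.+ + x ℤ.+ + y)
                                                             (B4≡B4⁺-B4⁻ {a} {suc b} refl refl) (B4≡B4⁺-B4⁻ {a} {b} refl refl) ⟩
  (+ p ℤ.- + q) ℤ.+ (+ p′ ℤ.- + q′) ℤ.+ + x ℤ.+ + y ≡⟨ regroup (+ p) (+ q) (+ p′) (+ q′) (+ x) (+ y) ⟩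
  (+ p ℤ.+ + p′ ℤ.+ + x ℤ.+ + y) ℤ.- (+ q ℤ.+ + q′) ≡⟨ cong₂ ℤ._-_ pos-+⁴ (ℤ.pos-+ q q′) ⟨
  + (p + p′ + x + y) ℤ.- + (q + q′)                 ∎
  where
  open ≡-Reasoning
  p p′ q q′ x y : ℕ
  p = B4⁺ (2 ^ a) (suc b)
  p′ = B4⁺ (2 ^ a) b
  q = B4⁻ (2 ^ suc b) (2 ^ (a ∸ suc b)) (suc b)
  q′ = B4⁻ (2 ^ b) (2 ^ (a ∸ b)) b
  x = 2 * 2 ^ suc a
  y = 2 * 2 ^ suc b * suc b
  regroup : ∀ p q p′ q′ x y → (p ℤ.- q) ℤ.+ (p′ ℤ.- q′) ℤ.+ x ℤ.+ y ≡ (p ℤ.+ p′ ℤ.+ x ℤ.+ y) ℤ.- (q ℤ.+ q′)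
  regroup = ℤ-Solver.solve-∀
  pos-+⁴ : + (p + p′ + x + y) ≡ + p ℤ.+ + p′ ℤ.+ + x ℤ.+ + y
  pos-+⁴ = trans (ℤ.pos-+ (p + p′ + x) y) (cong (ℤ._+ + y) (pos-+³ p p′ x))

4A≤4B : ∀ K R l → 1 ≤ R → 2 * K ≤ 2 + l * K →
        + A4⁺ (2 * (K * R)) K l ℤ.- + A4⁻ K R (2 * R) l
          ≤ℤ + B4⁺ (2 * (2 * (K * R))) (suc l) ℤ.- + B4⁻ (2 * K) (2 * R) (suc l)
4A≤4B K R l 1≤R 2K≤2+lK =
  [+m]-[+n]≤[+o]-[+p] {A⁺} {A⁻} {B⁺} {B⁻} (+-cancelʳ-≤ slack (A⁺ + B⁻) (B⁺ + A⁻) (begin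
  A⁺ + B⁻ + slack                                 ≤⟨ +-monoʳ-≤ (A⁺ + B⁻) (+-mono-≤ (*-monoʳ-≤ (2 * R) 2K≤2+lK) 2Kl≤2KlR) ⟩
  A⁺ + B⁻ + (2 * R * (2 + l * K) + 2 * K * l * R) ≡⟨ gap K R l ⟨
  B⁺ + A⁻ + slack                                 ∎))
  where
  open ≤-Reasoning
  A⁺ A⁻ B⁺ B⁻ slack : ℕ
  A⁺ = A4⁺ (2 * (K * R)) K l
  A⁻ = A4⁻ K R (2 * R) l
  B⁺ = B4⁺ (2 * (2 * (K * R))) (suc l)
  B⁻ = B4⁻ (2 * K) (2 * R) (suc l)
  slack = 2 * R * (2 * K) + 2 * K * l
  2Kl≤2KlR : 2 * K * l ≤ 2 * K * l * R
  2Kl≤2KlR = subst (_≤ 2 * K * l * R) (*-identityʳ (2 * K * l)) (*-monoʳ-≤ (2 * K * l) 1≤R)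
  gap : ∀ K R l →
        B4⁺ (2 * (2 * (K * R))) (suc l) + A4⁻ K R (2 * R) l + (2 * R * (2 * K) + 2 * K * l)
        ≡ A4⁺ (2 * (K * R)) K l + B4⁻ (2 * K) (2 * R) (suc l) + (2 * R * (2 + l * K) + 2 * K * l * R)
  gap = ℕ-Solver.solve-∀

lemma7 : (a b : ℕ) → 0 < b → b < a → A4 a b ≤ℤ B4 a b
lemma7 a (suc l) _ b<a with m≤n⇒∃[o]m+o≡n b<a
... | c , refl = begin
  A4 a (suc l) ≡⟨ A4≡A4⁺-A4⁻ {suc (l + c)} {l} (cong (2 *_) 2^[l+c]≡KR) (cong (2 ^_) (m+n∸m≡n l c)) 2^[1+l+c∸l]≡2R ⟩
  _            ≤⟨ 4A≤4B (2 ^ l) (2 ^ c) l (m^n>0 2 c) (2*2^n≤2+n*2^n l) ⟩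
  _            ≡⟨ B4≡B4⁺-B4⁻ {a} {suc l} (cong (λ x → 2 * (2 * x)) 2^[l+c]≡KR) 2^[1+l+c∸l]≡2R ⟨
  B4 a (suc l) ∎
  where
  open ℤ.≤-Reasoning
  2^[l+c]≡KR : 2 ^ (l + c) ≡ 2 ^ l * 2 ^ c
  2^[l+c]≡KR = ^-distribˡ-+-* 2 l c
  2^[1+l+c∸l]≡2R : 2 ^ (suc (l + c) ∸ l) ≡ 2 * 2 ^ c
  2^[1+l+c∸l]≡2R = cong (2 ^_) (suc[m+n]∸m≡suc[n] l c)
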